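{- Let $(\mathcal{M},d)$ be any metric space and let $A,B,C\in\mathcal{M}$ satisfy $d(B,C)\ge\max\{d(A,B),d(A,C)\}$. Then for any $O\in\mathcal{M}$, $d(O,A)\le\frac{3}{2}\left(d(O,B)+d(O,C)\right)$. -}

module Defs where

open import Level using (Level; _⊔_) renaming (suc to lsuc)
open import Algebra.Bundles using (CommutativeRing)
open import Relation.Binary.Core using (Rel)
open import Relation.Binary.Structures using (IsTotalOrder)
open import Relation.Binary.PropositionalEquality using (_≡_)
open import Relation.Nullary using (¬_)
open import Function.Metric.Core using (DistanceFunction)
open import Function.Metric.Structures using (IsGeneralMetric)

record OrderedField c ℓ : Set (lsuc (c ⊔ ℓ)) where
  field
    commutativeRing : CommutativeRing c ℓ
  open CommutativeRing commutativeRing public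
  infix 4 _≤_
  infix 8 _⁻¹
  field
    _≤_          : Rel Carrier ℓ
    isTotalOrder : IsTotalOrder _≈_ _≤_
    +-mono-≤     : ∀ {x y} z → x ≤ y → x + z ≤ y + z
    *-nonneg     : ∀ {x y} → 0# ≤ x → 0# ≤ y → 0# ≤ x * y
    0≉1          : ¬ (0# ≈ 1#)
    _⁻¹          : Carrier → Carrier
    ⁻¹-inverse   : ∀ x → ¬ (x ≈ 0#) → x * x ⁻¹ ≈ 1#

  two : Carrier
  two = 1# + 1#

  three : Carrier
  three = 1# + 1# + 1#

  threeHalves : Carrier
  threeHalves = three * two ⁻¹

IsMetricIn : ∀ {c ℓ m} (F : OrderedField c ℓ) (M : Set m) →
             DistanceFunction M (OrderedField.Carrier F) → Set (c ⊔ ℓ ⊔ m)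
IsMetricIn F M d = IsGeneralMetric _≡_ _≈_ _≤_ 0# _+_ d
  where open OrderedField F

{-# OPTIONS --safe #-}
-- Route A through B and through C: since B C is the longest side of the
-- triangle A B C, d(O,A) ≤ d(O,B) + d(B,A) ≤ d(O,B) + d(B,C)
-- ≤ 2 d(O,B) + d(O,C), and symmetrically d(O,A) ≤ d(O,B) + 2 d(O,C).
-- Adding the two bounds gives 2 d(O,A) ≤ 3 (d(O,B) + d(O,C)).
module Submission where

open import Defs
open import Function.Metric.Core using (DistanceFunction)
open import Function.Metric.Structures using (IsGeneralMetric)
open import Data.Sum using (inj₁; inj₂)
open import Relation.Nullary using (¬_; contradiction)
open import Relation.Binary.Bundles using (TotalOrder)

module OrderedFieldProperties {c ℓ} (F : OrderedField c ℓ) where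

  open OrderedField F renaming (+-mono-≤ to +-monoˡ-≤)
  open import Algebra.Properties.Ring ring
    using (-‿distribˡ-*; -‿distribʳ-*; -‿involutive)
  open import Algebra.Properties.CommutativeSemigroup +-commutativeSemigroup
    using (interchange)
  open import Algebra.Properties.CommutativeSemigroup *-commutativeSemigroup
    using (xy∙z≈xz∙y)

  totalOrder : TotalOrder c ℓ ℓ
  totalOrder = record { isTotalOrder = isTotalOrder }

  open TotalOrder totalOrder using (total; antisym; poset)
  open import Relation.Binary.Reasoning.PartialOrder poset

  +-monoʳ-≤ : ∀ {x y} z → x ≤ y → z + x ≤ z + y
  +-monoʳ-≤ {x} {y} z x≤y = begin
    z + x  ≈⟨ +-comm z x ⟩
    x + z  ≤⟨ +-monoˡ-≤ z x≤y ⟩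
    y + z  ≈⟨ +-comm y z ⟩
    z + y  ∎

  +-mono-≤ : ∀ {x y u v} → x ≤ y → u ≤ v → x + u ≤ y + v
  +-mono-≤ {x} {y} {u} {v} x≤y u≤v = begin
    x + u  ≤⟨ +-monoˡ-≤ u x≤y ⟩
    y + u  ≤⟨ +-monoʳ-≤ y u≤v ⟩
    y + v  ∎

  x≤0⇒0≤-x : ∀ {x} → x ≤ 0# → 0# ≤ - x
  x≤0⇒0≤-x {x} x≤0 = begin
    0#        ≈⟨ -‿inverseʳ x ⟨
    x + - x   ≤⟨ +-monoˡ-≤ (- x) x≤0 ⟩
    0# + - x  ≈⟨ +-identityˡ (- x) ⟩
    - x       ∎

  0≤-x⇒x≤0 : ∀ {x} → 0# ≤ - x → x ≤ 0#
  0≤-x⇒x≤0 {x} 0≤-x = begin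
    x        ≈⟨ +-identityˡ x ⟨
    0# + x   ≤⟨ +-monoˡ-≤ x 0≤-x ⟩
    - x + x  ≈⟨ -‿inverseˡ x ⟩
    0#       ∎

  -x*-x≈x*x : ∀ x → - x * - x ≈ x * x
  -x*-x≈x*x x = begin-equality
    - x * - x      ≈⟨ -‿distribˡ-* x (- x) ⟨
    - (x * - x)    ≈⟨ -‿cong (-‿distribʳ-* x x) ⟨
    - (- (x * x))  ≈⟨ -‿involutive (x * x) ⟩
    x * x          ∎

  0≤x*x : ∀ x → 0# ≤ x * x
  0≤x*x x with total 0# x
  ... | inj₁ 0≤x = *-nonneg 0≤x 0≤x
  ... | inj₂ x≤0 = begin
    0#         ≤⟨ *-nonneg 0≤-x 0≤-x ⟩
    - x * - x  ≈⟨ -x*-x≈x*x x ⟩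
    x * x      ∎
    where 0≤-x = x≤0⇒0≤-x x≤0

  0≤1 : 0# ≤ 1#
  0≤1 = begin
    0#       ≤⟨ 0≤x*x 1# ⟩
    1# * 1#  ≈⟨ *-identityʳ 1# ⟩
    1#       ∎

  0≤x⇒0≤x⁻¹ : ∀ {x} → ¬ (x ≈ 0#) → 0# ≤ x → 0# ≤ x ⁻¹
  0≤x⇒0≤x⁻¹ {x} x≉0 0≤x with total 0# (x ⁻¹)
  ... | inj₁ 0≤x⁻¹ = 0≤x⁻¹
  ... | inj₂ x⁻¹≤0 = contradiction (antisym 0≤1 (0≤-x⇒x≤0 0≤-1)) 0≉1
    where
    0≤-1 : 0# ≤ - 1#
    0≤-1 = begin
      0#            ≤⟨ *-nonneg 0≤x (x≤0⇒0≤-x x⁻¹≤0) ⟩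
      x * - (x ⁻¹)  ≈⟨ -‿distribʳ-* x (x ⁻¹) ⟨
      - (x * x ⁻¹)  ≈⟨ -‿cong (⁻¹-inverse x x≉0) ⟩
      - 1#          ∎

  *-monoˡ-≤-nonNeg : ∀ {x y z} → 0# ≤ z → x ≤ y → x * z ≤ y * z
  *-monoˡ-≤-nonNeg {x} {y} {z} 0≤z x≤y = begin
    x * z                    ≈⟨ +-identityˡ (x * z) ⟨
    0# + x * z               ≤⟨ +-monoˡ-≤ (x * z) (*-nonneg 0≤y-x 0≤z) ⟩
    (y - x) * z + x * z      ≈⟨ distribʳ z (y - x) x ⟨
    ((y - x) + x) * z        ≈⟨ *-cong y-x+x≈y refl ⟩
    y * z                    ∎
    where
    0≤y-x : 0# ≤ y - x
    0≤y-x = begin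
      0#      ≈⟨ -‿inverseʳ x ⟨
      x - x   ≤⟨ +-monoˡ-≤ (- x) x≤y ⟩
      y - x   ∎
    y-x+x≈y : (y - x) + x ≈ y
    y-x+x≈y = begin-equality
      (y - x) + x    ≈⟨ +-assoc y (- x) x ⟩
      y + (- x + x)  ≈⟨ +-cong refl (-‿inverseˡ x) ⟩
      y + 0#         ≈⟨ +-identityʳ y ⟩
      y              ∎

  two*x≈x+x : ∀ x → two * x ≈ x + x
  two*x≈x+x x = begin-equality
    (1# + 1#) * x       ≈⟨ distribʳ x 1# 1# ⟩
    1# * x + 1# * x     ≈⟨ +-cong (*-identityˡ x) (*-identityˡ x) ⟩
    x + x               ∎

  three*x≈x+x+x : ∀ x → three * x ≈ x + x + x
  three*x≈x+x+x x = begin-equality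
    (two + 1#) * x      ≈⟨ distribʳ x two 1# ⟩
    two * x + 1# * x    ≈⟨ +-cong (two*x≈x+x x) (*-identityˡ x) ⟩
    x + x + x           ∎

  two≉0 : ¬ (two ≈ 0#)
  two≉0 two≈0 = 0≉1 (antisym 0≤1 1≤0)
    where
    1≤0 : 1# ≤ 0#
    1≤0 = begin
      1#        ≈⟨ +-identityˡ 1# ⟨
      0# + 1#   ≤⟨ +-monoˡ-≤ 1# 0≤1 ⟩
      two       ≈⟨ two≈0 ⟩
      0#        ∎

  0≤two : 0# ≤ two
  0≤two = begin
    0#       ≈⟨ +-identityˡ 0# ⟨
    0# + 0#  ≤⟨ +-mono-≤ 0≤1 0≤1 ⟩
    two      ∎

  0≤two⁻¹ : 0# ≤ two ⁻¹
  0≤two⁻¹ = 0≤x⇒0≤x⁻¹ two≉0 0≤two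

  x+x≤y⇒x≤y*two⁻¹ : ∀ {x y} → x + x ≤ y → x ≤ y * two ⁻¹
  x+x≤y⇒x≤y*two⁻¹ {x} {y} x+x≤y = begin
    x                      ≈⟨ *-identityʳ x ⟨
    x * 1#                 ≈⟨ *-cong refl (⁻¹-inverse two two≉0) ⟨
    x * (two * two ⁻¹)     ≈⟨ *-assoc x two (two ⁻¹) ⟨
    (x * two) * two ⁻¹     ≈⟨ *-cong (trans (*-comm x two) (two*x≈x+x x)) refl ⟩
    (x + x) * two ⁻¹       ≤⟨ *-monoˡ-≤-nonNeg 0≤two⁻¹ x+x≤y ⟩
    y * two ⁻¹             ∎

  x+x≤three*y⇒x≤threeHalves*y : ∀ {x y} → x + x ≤ three * y → x ≤ threeHalves * y
  x+x≤three*y⇒x≤threeHalves*y {x} {y} x+x≤3y = begin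
    x                     ≤⟨ x+x≤y⇒x≤y*two⁻¹ x+x≤3y ⟩
    (three * y) * two ⁻¹  ≈⟨ xy∙z≈xz∙y three y (two ⁻¹) ⟩
    threeHalves * y       ∎

  [x+[x+y]]+[y+[y+x]]≈three*[x+y] : ∀ x y → (x + (x + y)) + (y + (y + x)) ≈ three * (x + y)
  [x+[x+y]]+[y+[y+x]]≈three*[x+y] x y = begin-equality
    (x + (x + y)) + (y + (y + x))    ≈⟨ +-cong refl (+-cong refl (+-comm y x)) ⟩
    (x + (x + y)) + (y + (x + y))    ≈⟨ interchange x (x + y) y (x + y) ⟩
    (x + y) + ((x + y) + (x + y))    ≈⟨ +-assoc (x + y) (x + y) (x + y) ⟨
    (x + y) + (x + y) + (x + y)      ≈⟨ three*x≈x+x+x (x + y) ⟨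
    three * (x + y)                  ∎

module MetricProperties {c ℓ m} (F : OrderedField c ℓ) {M : Set m}
  {d : DistanceFunction M (OrderedField.Carrier F)} (metric : IsMetricIn F M d) where

  open OrderedField F using (_≤_; _+_; +-cong; refl)
  open OrderedFieldProperties F using (totalOrder; +-monoʳ-≤)
  open TotalOrder totalOrder using (poset)
  open IsGeneralMetric metric using (triangle; sym)
  open import Relation.Binary.Reasoning.PartialOrder poset

  triangle-from : ∀ o x y → d x y ≤ d o x + d o y
  triangle-from o x y = begin
    d x y          ≤⟨ triangle x o y ⟩
    d x o + d o y  ≈⟨ +-cong (sym x o) refl ⟩
    d o x + d o y  ∎

  dist-≤-via-shorter-side : ∀ {a b c} o → d a b ≤ d b c →
                            d o a ≤ d o b + (d o b + d o c)
  dist-≤-via-shorter-side {a} {b} {c} o ab≤bc = begin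
    d o a                  ≤⟨ triangle o b a ⟩
    d o b + d b a          ≈⟨ +-cong refl (sym b a) ⟩
    d o b + d a b          ≤⟨ +-monoʳ-≤ (d o b) ab≤bc ⟩
    d o b + d b c          ≤⟨ +-monoʳ-≤ (d o b) (triangle-from o b c) ⟩
    d o b + (d o b + d o c)  ∎

lemma2 : ∀ {c ℓ m} (F : OrderedField c ℓ) (M : Set m)
           (d : DistanceFunction M (OrderedField.Carrier F)) →
           IsMetricIn F M d →
           ∀ (A B C : M) →
           OrderedField._≤_ F (d A B) (d B C) →
           OrderedField._≤_ F (d A C) (d B C) →
           ∀ (O : M) →
           OrderedField._≤_ F (d O A)
             (OrderedField._*_ F (OrderedField.threeHalves F)
               (OrderedField._+_ F (d O B) (d O C)))
lemma2 F M d metric A B C AB≤BC AC≤BC O = x+x≤three*y⇒x≤threeHalves*y (begin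
  d O A + d O A                                         ≤⟨ +-mono-≤ via-B via-C ⟩
  (d O B + (d O B + d O C)) + (d O C + (d O C + d O B)) ≈⟨ [x+[x+y]]+[y+[y+x]]≈three*[x+y] _ _ ⟩
  three * (d O B + d O C)                               ∎)
  where
  open OrderedField F using (_≤_; _+_; _*_; three)
  open OrderedFieldProperties F
  open MetricProperties F metric
  open IsGeneralMetric metric using (sym)
  open TotalOrder totalOrder using (poset; ≤-respʳ-≈)
  open import Relation.Binary.Reasoning.PartialOrder poset

  via-B : d O A ≤ d O B + (d O B + d O C)
  via-B = dist-≤-via-shorter-side O AB≤BC

  via-C : d O A ≤ d O C + (d O C + d O B)
  via-C = dist-≤-via-shorter-side O (≤-respʳ-≈ (sym B C) AC≤BC)
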